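{- Let $n,k_1,k_2\ge 0$ with $\ell=n-k_1-k_2\ge 0$. If $G\in\mathcal{T}$, then there is a matrix $G'\in\mathcal{U}$ such that the $\mathbb{Z}_4$-codes generated by (the rows of) $G$ and $G'$ are equivalent.
   Context: $\mathbb{Z}_4=\{0,1,2,3\}$ is the ring of integers modulo $4$; a $\mathbb{Z}_4$-code of length $n$ is a submodule of $\mathbb{Z}_4^n$, and the code generated by a matrix is the $\mathbb{Z}_4$-span of its rows. Two codes are equivalent if $C'=CP$ for a monomial matrix $P$ with nonzero entries in $\{1,-1\}$. Order $\mathbb{Z}_4$ by $0<1<2<3$ and order $\mathbb{Z}_4^m$ lexicographically. $M_{m\times n}(R)$ is the set of $m\times n$ matrices with entries in $R$. For $T\subseteq M_{m\times n}(\mathbb{Z}_4)$, $P_{row}(T)$ is the set of matrices in $T$ whose rows $a_1,\dots,a_m$ satisfy $a_i\le a_j$ whenever $i\le j$. For a $k_1\times k_2$ $(0,1)$-matrix $A$, a $k_1\times \ell$ $\mathbb{Z}_4$-matrix $B$ and a $k_2\times\ell$ $(0,1)$-matrix $D$, let $G(A,B,D)=\begin{pmatrix} I_{k_1}&A&B\\ O&2I_{k_2}&2D\end{pmatrix}$. Let $\mathcal{S}=\{G(A,B,D)\mid A\in M_{k_1\times k_2}(\{0,1\}),B\in M_{k_1\times\ell}(\mathbb{Z}_4),D\in M_{k_2\times\ell}(\{0,1\})\}$, $\mathcal{T}=\{G(A,B,D)\in\mathcal{S}\mid A\in P_{row}(M_{k_1\times k_2}(\{0,1\}))\}$, and $\mathcal{U}=\{G(A,B,D)\in\mathcal{T}\mid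 B\in\mathcal{B}\}$, where $\mathcal{B}$ is the set consisting of all $k_1\times\ell$ matrices with entries in $\{0,2\}$ together with all $k_1\times\ell$ $\mathbb{Z}_4$-matrices $B$ such that, for the smallest $i\in\{1,\dots,k_1\}$ for which the $i$-th row of $B$ contains an entry not in $\{0,2\}$, the $i$-th row of $B$ contains only entries in $\{0,1,2\}$. -}

module Defs where

open import Data.Nat using (ℕ; zero; suc; _+_)
open import Data.Fin using (Fin; zero; suc; splitAt; _≤_)
open import Data.Sum using (_⊎_; inj₁; inj₂)
open import Data.Product using (Σ; _×_; _,_; ∃)
open import Data.Bool using (Bool; true; false)
open import Data.Unit using (⊤)
open import Data.Empty using (⊥)
open import Relation.Binary.PropositionalEquality using (_≡_; _≢_)
open import Relation.Nullary using (¬_)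

data ℤ₄ : Set where
  z0 z1 z2 z3 : ℤ₄

infixl 6 _+₄_
infixl 7 _*₄_

_+₄_ : ℤ₄ → ℤ₄ → ℤ₄
z0 +₄ y = y
z1 +₄ z0 = z1
z1 +₄ z1 = z2
z1 +₄ z2 = z3
z1 +₄ z3 = z0
z2 +₄ z0 = z2
z2 +₄ z1 = z3
z2 +₄ z2 = z0
z2 +₄ z3 = z1
z3 +₄ z0 = z3
z3 +₄ z1 = z0
z3 +₄ z2 = z1
z3 +₄ z3 = z2

_*₄_ : ℤ₄ → ℤ₄ → ℤ₄
z0 *₄ y = z0
z1 *₄ y = y
z2 *₄ z0 = z0
z2 *₄ z1 = z2
z2 *₄ z2 = z0
z2 *₄ z3 = z2
z3 *₄ z0 = z0
z3 *₄ z1 = z3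
z3 *₄ z2 = z2
z3 *₄ z3 = z1

rank : ℤ₄ → ℕ
rank z0 = 0
rank z1 = 1
rank z2 = 2
rank z3 = 3

_<₄_ : ℤ₄ → ℤ₄ → Set
x <₄ y = Data.Nat._<_ (rank x) (rank y)

Vec₄ : ℕ → Set
Vec₄ n = Fin n → ℤ₄

Mat : ℕ → ℕ → Set → Set
Mat m n A = Fin m → Fin n → A

Σ₄ : (n : ℕ) → (Fin n → ℤ₄) → ℤ₄
Σ₄ zero f = z0
Σ₄ (suc n) f = f zero +₄ Σ₄ n (λ i → f (suc i))

_·_ : ∀ {m n p} → Mat m n ℤ₄ → Mat n p ℤ₄ → Mat m p ℤ₄
_·_ {n = n} M N i k = Σ₄ n (λ j → M i j *₄ N j k)

_⊙_ : ∀ {m n} → Vec₄ m → Mat m n ℤ₄ → Vec₄ n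
_⊙_ {m = m} x M j = Σ₄ m (λ i → x i *₄ M i j)

_≤lex_ : ∀ {m} → Vec₄ m → Vec₄ m → Set
_≤lex_ {zero} a b = ⊤
_≤lex_ {suc m} a b =
  (a zero <₄ b zero) ⊎ ((a zero ≡ b zero) × ((λ i → a (suc i)) ≤lex (λ i → b (suc i))))

Prow : ∀ {m n} → Mat m n ℤ₄ → Set
Prow {m} M = (i j : Fin m) → i ≤ j → M i ≤lex M j

Code : ∀ {m n} → Mat m n ℤ₄ → Vec₄ n → Set
Code {m} G x = Σ (Vec₄ m) λ c → ∀ j → x j ≡ (c ⊙ G) j

IsUnitEntry : ℤ₄ → Set
IsUnitEntry x = (x ≡ z1) ⊎ (x ≡ z3)

IsSignedMonomial : ∀ {n} → Mat n n ℤ₄ → Set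
IsSignedMonomial {n} P =
  (∀ i j → (P i j ≡ z0) ⊎ IsUnitEntry (P i j)) ×
  (∀ i → Σ (Fin n) λ j → (P i j ≢ z0) × (∀ j' → P i j' ≢ z0 → j' ≡ j)) ×
  (∀ j → Σ (Fin n) λ i → (P i j ≢ z0) × (∀ i' → P i' j ≢ z0 → i' ≡ i))

ImageCode : ∀ {n} → (Vec₄ n → Set) → Mat n n ℤ₄ → Vec₄ n → Set
ImageCode {n} C P y = Σ (Vec₄ n) λ x → C x × (∀ j → y j ≡ (x ⊙ P) j)

Equivalent : ∀ {n} → (Vec₄ n → Set) → (Vec₄ n → Set) → Set
Equivalent {n} C C' = Σ (Mat n n ℤ₄) λ P → IsSignedMonomial P ×
  ((∀ y → C' y → ImageCode C P y) × (∀ y → ImageCode C P y → C' y))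

bit : Bool → ℤ₄
bit false = z0
bit true = z1

dbl : Bool → ℤ₄
dbl false = z0
dbl true = z2

idB : ∀ {k} → Fin k → Fin k → Bool
idB zero zero = true
idB zero (suc j) = false
idB (suc i) zero = false
idB (suc i) (suc j) = idB i j

-- G(A,B,D) = [ I  A   B  ]
--            [ O  2I  2D ]
-- of size (k1+k2) × ((k1+k2)+ℓ)
GABD : ∀ {k₁ k₂ ℓ} → Mat k₁ k₂ Bool → Mat k₁ ℓ ℤ₄ → Mat k₂ ℓ Bool →
       Mat (k₁ + k₂) ((k₁ + k₂) + ℓ) ℤ₄
GABD {k₁} {k₂} {ℓ} A B D r c with splitAt k₁ r | splitAt (k₁ + k₂) c
... | inj₁ i | inj₁ c' with splitAt k₁ c'
...   | inj₁ j = bit (idB i j)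
...   | inj₂ j = bit (A i j)
GABD {k₁} {k₂} {ℓ} A B D r c | inj₁ i | inj₂ j = B i j
GABD {k₁} {k₂} {ℓ} A B D r c | inj₂ i | inj₁ c' with splitAt k₁ c'
...   | inj₁ j = z0
...   | inj₂ j = dbl (idB i j)
GABD {k₁} {k₂} {ℓ} A B D r c | inj₂ i | inj₂ j = dbl (D i j)

bitMat : ∀ {m n} → Mat m n Bool → Mat m n ℤ₄
bitMat A i j = bit (A i j)

Even₄ : ℤ₄ → Set
Even₄ x = (x ≡ z0) ⊎ (x ≡ z2)

InB : ∀ {k₁ ℓ} → Mat k₁ ℓ ℤ₄ → Set
InB {k₁} {ℓ} B =
  (∀ i j → Even₄ (B i j)) ⊎
  (Σ (Fin k₁) λ i →
     (Σ (Fin ℓ) λ j → ¬ Even₄ (B i j)) ×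
     (∀ i' → Data.Fin._<_ i' i → ∀ j → Even₄ (B i' j)) ×
     (∀ j → B i j ≢ z3))

module Submission where

-- Multiplying the last ℓ columns of G(A,B,D) by signs ±1 is right
-- multiplication by a signed diagonal matrix, hence yields an equivalent code.
-- It leaves the blocks I, A, 2I untouched and, since 2·(−1) = 2 in ℤ₄, also
-- the block 2D; its only effect is to replace B by B·diag(t).  If every entry
-- of B is even, B already lies in 𝓑.  Otherwise let i be the first row of B
-- with an odd entry and negate exactly the columns j with B i j = 3: the row i
-- then avoids 3, rows above i stay even (negation preserves parity), so the
-- new matrix lies in 𝓑 while A (hence its row ordering) and D are unchanged.

open import Defs
open import Data.Nat using (ℕ; zero; suc; _+_; s≤s)
import Data.Nat as ℕ
open import Data.Fin using (Fin; zero; suc; splitAt; _<_; Fin′; inject)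
open import Data.Fin.Properties using (all?; ¬∀⟶∃¬; ¬∀⟶∃¬-smallest)
open import Data.Bool using (Bool; true; false)
open import Data.Sum using (_⊎_; inj₁; inj₂)
open import Data.Empty using (⊥-elim)
open import Data.Product using (Σ; ∃; _×_; _,_)
open import Relation.Binary.Definitions using (DecidableEquality)
open import Relation.Binary.PropositionalEquality
  using (_≡_; _≢_; refl; sym; trans; cong; cong₂; subst; module ≡-Reasoning)
open import Relation.Nullary using (¬_; Dec; yes; no)
open import Relation.Nullary.Decidable using (map′; _×-dec_; _⊎-dec_; from-yes)
open import Relation.Unary using (Decidable)

fromRank : ℕ → ℤ₄
fromRank 0 = z0
fromRank 1 = z1
fromRank 2 = z2
fromRank _ = z3

fromRank-rank : ∀ x → fromRank (rank x) ≡ x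
fromRank-rank z0 = refl
fromRank-rank z1 = refl
fromRank-rank z2 = refl
fromRank-rank z3 = refl

rank-injective : ∀ {x y} → rank x ≡ rank y → x ≡ y
rank-injective {x} {y} eq =
  trans (sym (fromRank-rank x)) (trans (cong fromRank eq) (fromRank-rank y))

infix 4 _≟₄_
_≟₄_ : DecidableEquality ℤ₄
x ≟₄ y = map′ rank-injective (cong rank) (rank x ℕ.≟ rank y)

-- A decidable property holds everywhere on ℤ₄ iff it holds at its four
-- elements; this lets ring identities of ℤ₄ be proved by evaluation.
∀₄? : {P : ℤ₄ → Set} → Decidable P → Dec (∀ x → P x)
∀₄? P? = map′ (λ { (p0 , p1 , p2 , p3) z0 → p0 ; (p0 , p1 , p2 , p3) z1 → p1
                 ; (p0 , p1 , p2 , p3) z2 → p2 ; (p0 , p1 , p2 , p3) z3 → p3 })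
              (λ h → h z0 , h z1 , h z2 , h z3)
              (P? z0 ×-dec P? z1 ×-dec P? z2 ×-dec P? z3)

*-identityʳ : ∀ x → x *₄ z1 ≡ x
*-identityʳ = from-yes (∀₄? λ x → x *₄ z1 ≟₄ x)

*-zeroʳ : ∀ x → x *₄ z0 ≡ z0
*-zeroʳ = from-yes (∀₄? λ x → x *₄ z0 ≟₄ z0)

+-identityʳ : ∀ x → x +₄ z0 ≡ x
+-identityʳ = from-yes (∀₄? λ x → x +₄ z0 ≟₄ x)

*-assoc : ∀ x y z → (x *₄ y) *₄ z ≡ x *₄ (y *₄ z)
*-assoc = from-yes (∀₄? λ x → ∀₄? λ y → ∀₄? λ z → (x *₄ y) *₄ z ≟₄ x *₄ (y *₄ z))

*-distribʳ-+ : ∀ x y z → (x +₄ y) *₄ z ≡ x *₄ z +₄ y *₄ z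
*-distribʳ-+ = from-yes (∀₄? λ x → ∀₄? λ y → ∀₄? λ z →
                 (x +₄ y) *₄ z ≟₄ x *₄ z +₄ y *₄ z)

Σ₄-cong : ∀ n {f g : Fin n → ℤ₄} → (∀ i → f i ≡ g i) → Σ₄ n f ≡ Σ₄ n g
Σ₄-cong zero    f≗g = refl
Σ₄-cong (suc n) f≗g = cong₂ _+₄_ (f≗g zero) (Σ₄-cong n (λ i → f≗g (suc i)))

Σ₄-*ʳ : ∀ n (f : Fin n → ℤ₄) a → Σ₄ n f *₄ a ≡ Σ₄ n (λ i → f i *₄ a)
Σ₄-*ʳ zero    f a = refl
Σ₄-*ʳ (suc n) f a =
  trans (*-distribʳ-+ (f zero) _ a) (cong (f zero *₄ a +₄_) (Σ₄-*ʳ n (λ i → f (suc i)) a))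

Σ₄-zero : ∀ n (f : Fin n → ℤ₄) → Σ₄ n (λ i → f i *₄ z0) ≡ z0
Σ₄-zero zero    f = refl
Σ₄-zero (suc n) f = cong₂ _+₄_ (*-zeroʳ (f zero)) (Σ₄-zero n (λ i → f (suc i)))

diag : ∀ {n} → Vec₄ n → Mat n n ℤ₄
diag s zero    zero    = s zero
diag s zero    (suc j) = z0
diag s (suc i) zero    = z0
diag s (suc i) (suc j) = diag (λ k → s (suc k)) i j

⊙-diag : ∀ {n} (x s : Vec₄ n) j → (x ⊙ diag s) j ≡ x j *₄ s j
⊙-diag {suc n} x s zero =
  trans (cong (x zero *₄ s zero +₄_) (Σ₄-zero n (λ i → x (suc i)))) (+-identityʳ _)
⊙-diag {suc n} x s (suc j) =
  cong₂ _+₄_ (*-zeroʳ (x zero)) (⊙-diag (λ i → x (suc i)) (λ k → s (suc k)) j)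

unit≢0 : ∀ {x} → IsUnitEntry x → x ≢ z0
unit≢0 (inj₁ refl) ()
unit≢0 (inj₂ refl) ()

diag-offDiagonal : ∀ {n} (s : Vec₄ n) i j → diag s i j ≢ z0 → i ≡ j
diag-offDiagonal s zero    zero    _  = refl
diag-offDiagonal s zero    (suc j) ne = ⊥-elim (ne refl)
diag-offDiagonal s (suc i) zero    ne = ⊥-elim (ne refl)
diag-offDiagonal s (suc i) (suc j) ne =
  cong suc (diag-offDiagonal (λ k → s (suc k)) i j ne)

diag-signedMonomial : ∀ {n} (s : Vec₄ n) → (∀ k → IsUnitEntry (s k)) →
                      IsSignedMonomial (diag s)
diag-signedMonomial s units =
  entries s units ,
  (λ i → i , onDiagonal s units i , λ j ne → sym (diag-offDiagonal s i j ne)) ,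
  (λ j → j , onDiagonal s units j , λ i ne → diag-offDiagonal s i j ne)
  where
  entries : ∀ {n} (s : Vec₄ n) → (∀ k → IsUnitEntry (s k)) →
            ∀ i j → (diag s i j ≡ z0) ⊎ IsUnitEntry (diag s i j)
  entries s units zero    zero    = inj₂ (units zero)
  entries s units zero    (suc j) = inj₁ refl
  entries s units (suc i) zero    = inj₁ refl
  entries s units (suc i) (suc j) = entries (λ k → s (suc k)) (λ k → units (suc k)) i j

  onDiagonal : ∀ {n} (s : Vec₄ n) → (∀ k → IsUnitEntry (s k)) → ∀ i → diag s i i ≢ z0
  onDiagonal s units zero    = unit≢0 (units zero)
  onDiagonal s units (suc i) = onDiagonal (λ k → s (suc k)) (λ k → units (suc k)) i

ColumnScaled : ∀ {m n} → Mat m n ℤ₄ → Vec₄ n → Mat m n ℤ₄ → Set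
ColumnScaled G s G' = ∀ r c → G' r c ≡ G r c *₄ s c

⊙-columnScaled : ∀ {m n} {G G' : Mat m n ℤ₄} {s : Vec₄ n} → ColumnScaled G s G' →
                 ∀ (x : Vec₄ m) c → (x ⊙ G') c ≡ (x ⊙ G) c *₄ s c
⊙-columnScaled {m} {G = G} {G'} {s} scaled x c = begin
  Σ₄ m (λ r → x r *₄ G' r c)          ≡⟨ Σ₄-cong m (λ r → cong (x r *₄_) (scaled r c)) ⟩
  Σ₄ m (λ r → x r *₄ (G r c *₄ s c))  ≡⟨ Σ₄-cong m (λ r → sym (*-assoc (x r) (G r c) (s c))) ⟩
  Σ₄ m (λ r → (x r *₄ G r c) *₄ s c)  ≡⟨ sym (Σ₄-*ʳ m (λ r → x r *₄ G r c) (s c)) ⟩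
  Σ₄ m (λ r → x r *₄ G r c) *₄ s c    ∎
  where open ≡-Reasoning

columnScaled-equivalent : ∀ {m n} {G G' : Mat m n ℤ₄} {s : Vec₄ n} →
  (∀ c → IsUnitEntry (s c)) → ColumnScaled G s G' → Equivalent (Code G) (Code G')
columnScaled-equivalent {G = G} {G'} {s} units scaled =
  diag s , diag-signedMonomial s units , toImage , fromImage
  where
  toImage : ∀ y → Code G' y → ImageCode (Code G) (diag s) y
  toImage y (x , y≡xG') = (x ⊙ G) , (x , λ _ → refl) , λ c → begin
    y c                      ≡⟨ y≡xG' c ⟩
    (x ⊙ G') c               ≡⟨ ⊙-columnScaled {G = G} {G'} scaled x c ⟩
    (x ⊙ G) c *₄ s c         ≡⟨ sym (⊙-diag (x ⊙ G) s c) ⟩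
    ((x ⊙ G) ⊙ diag s) c     ∎
    where open ≡-Reasoning

  fromImage : ∀ y → ImageCode (Code G) (diag s) y → Code G' y
  fromImage y (w , (x , w≡xG) , y≡wP) = x , λ c → begin
    y c                      ≡⟨ y≡wP c ⟩
    (w ⊙ diag s) c           ≡⟨ ⊙-diag w s c ⟩
    w c *₄ s c               ≡⟨ cong (_*₄ s c) (w≡xG c) ⟩
    (x ⊙ G) c *₄ s c         ≡⟨ sym (⊙-columnScaled {G = G} {G'} scaled x c) ⟩
    (x ⊙ G') c               ∎
    where open ≡-Reasoning

sgn : Bool → ℤ₄
sgn false = z1
sgn true  = z3

sgn-unit : ∀ b → IsUnitEntry (sgn b)
sgn-unit false = inj₁ refl
sgn-unit true  = inj₂ refl

-- 2 = −2 in ℤ₄, so the entries 0 and 2 are fixed by every sign.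
dbl-sgn : ∀ b t → dbl b *₄ sgn t ≡ dbl b
dbl-sgn false false = refl
dbl-sgn false true  = refl
dbl-sgn true  false = refl
dbl-sgn true  true  = refl

signCols : ∀ {k ℓ} → Mat k ℓ ℤ₄ → (Fin ℓ → Bool) → Mat k ℓ ℤ₄
signCols B t i j = B i j *₄ sgn (t j)

columnSigns : ∀ {m ℓ} → (Fin ℓ → Bool) → Vec₄ (m + ℓ)
columnSigns {m} t c with splitAt m c
... | inj₁ _ = z1
... | inj₂ j = sgn (t j)

columnSigns-unit : ∀ {m ℓ} (t : Fin ℓ → Bool) c → IsUnitEntry (columnSigns {m} t c)
columnSigns-unit {m} t c with splitAt m c
... | inj₁ _ = inj₁ refl
... | inj₂ j = sgn-unit (t j)

GABD-signCols : ∀ {k₁ k₂ ℓ} (A : Mat k₁ k₂ Bool) (B : Mat k₁ ℓ ℤ₄) (D : Mat k₂ ℓ Bool)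
  (t : Fin ℓ → Bool) →
  ColumnScaled (GABD A B D) (columnSigns {k₁ + k₂} t) (GABD A (signCols B t) D)
GABD-signCols {k₁} {k₂} A B D t r c with splitAt k₁ r | splitAt (k₁ + k₂) c
... | inj₁ i | inj₁ c' with splitAt k₁ c'
...   | inj₁ j = sym (*-identityʳ _)
...   | inj₂ j = sym (*-identityʳ _)
GABD-signCols A B D t r c | inj₁ i | inj₂ j = refl
GABD-signCols {k₁} A B D t r c | inj₂ i | inj₁ c' with splitAt k₁ c'
...   | inj₁ j = refl
...   | inj₂ j = sym (*-identityʳ _)
GABD-signCols A B D t r c | inj₂ i | inj₂ j = sym (dbl-sgn (D i j) (t j))

GABD-signCols-equivalent : ∀ {k₁ k₂ ℓ} (A : Mat k₁ k₂ Bool) (B : Mat k₁ ℓ ℤ₄)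
  (D : Mat k₂ ℓ Bool) (t : Fin ℓ → Bool) →
  Equivalent (Code (GABD A B D)) (Code (GABD A (signCols B t) D))
GABD-signCols-equivalent {k₁} {k₂} A B D t =
  columnScaled-equivalent (columnSigns-unit {k₁ + k₂} t) (GABD-signCols A B D t)

even? : Decidable Even₄
even? x = x ≟₄ z0 ⊎-dec x ≟₄ z2

-- Signs preserve parity; being an involution, they preserve oddness too.
signed-even : ∀ {x} b → Even₄ x → Even₄ (x *₄ sgn b)
signed-even false (inj₁ refl) = inj₁ refl
signed-even true  (inj₁ refl) = inj₁ refl
signed-even false (inj₂ refl) = inj₂ refl
signed-even true  (inj₂ refl) = inj₂ refl

sgn-square : ∀ b → sgn b *₄ sgn b ≡ z1
sgn-square false = refl
sgn-square true  = refl

sgn-involutive : ∀ x b → (x *₄ sgn b) *₄ sgn b ≡ x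
sgn-involutive x b = begin
  (x *₄ sgn b) *₄ sgn b  ≡⟨ *-assoc x (sgn b) (sgn b) ⟩
  x *₄ (sgn b *₄ sgn b)  ≡⟨ cong (x *₄_) (sgn-square b) ⟩
  x *₄ z1                ≡⟨ *-identityʳ x ⟩
  x                      ∎
  where open ≡-Reasoning

signed-odd : ∀ {x} b → ¬ Even₄ x → ¬ Even₄ (x *₄ sgn b)
signed-odd {x} b odd even = odd (subst Even₄ (sgn-involutive x b) (signed-even b even))

normalizingSign : ℤ₄ → Bool
normalizingSign z3 = true
normalizingSign _  = false

normalizingSign-avoids3 : ∀ x → x *₄ sgn (normalizingSign x) ≢ z3
normalizingSign-avoids3 z0 ()
normalizingSign-avoids3 z1 ()
normalizingSign-avoids3 z2 ()
normalizingSign-avoids3 z3 ()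

inject-onto : ∀ {n} {i i' : Fin n} → i' < i → ∃ λ (j : Fin′ i) → inject j ≡ i'
inject-onto {i = suc i} {zero}   _         = zero , refl
inject-onto {i = suc i} {suc i'} (s≤s i'<i) with inject-onto i'<i
... | j , inject-j≡i' = suc j , cong suc inject-j≡i'

EvenRow : ∀ {k ℓ} → Mat k ℓ ℤ₄ → Fin k → Set
EvenRow B i = ∀ j → Even₄ (B i j)

evenRow? : ∀ {k ℓ} (B : Mat k ℓ ℤ₄) → Decidable (EvenRow B)
evenRow? B i = all? (λ j → even? (B i j))

firstOddRow : ∀ {k ℓ} (B : Mat k ℓ ℤ₄) →
  (∀ i → EvenRow B i) ⊎
  Σ (Fin k) λ i → (Σ (Fin ℓ) λ j → ¬ Even₄ (B i j)) × (∀ i' → i' < i → EvenRow B i')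
firstOddRow {k} {ℓ} B with all? (evenRow? B)
... | yes allEven = inj₁ allEven
... | no notAllEven with ¬∀⟶∃¬-smallest k (EvenRow B) (evenRow? B) notAllEven
... | i , oddRow , earlierEven =
  inj₂ (i , ¬∀⟶∃¬ ℓ _ (λ j → even? (B i j)) oddRow , earlier)
  where
  earlier : ∀ i' → i' < i → EvenRow B i'
  earlier i' i'<i with inject-onto i'<i
  ... | j , refl = earlierEven j

signCols-into-𝓑 : ∀ {k ℓ} (B : Mat k ℓ ℤ₄) → Σ (Fin ℓ → Bool) λ t → InB (signCols B t)
signCols-into-𝓑 {ℓ = ℓ} B with firstOddRow B
... | inj₁ allEven = (λ _ → false) , inj₁ (λ i j → signed-even false (allEven i j))
... | inj₂ (i , (j , odd) , earlierEven) =
  t , inj₂ (i , (j , signed-odd (t j) odd) ,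
            (λ i' i'<i j' → signed-even (t j') (earlierEven i' i'<i j')) ,
            (λ j' → normalizingSign-avoids3 (B i j')))
  where
  t : Fin ℓ → Bool
  t j' = normalizingSign (B i j')

lemma5p2 : (k₁ k₂ ℓ : ℕ) (A : Mat k₁ k₂ Bool) (B : Mat k₁ ℓ ℤ₄) (D : Mat k₂ ℓ Bool) →
    Prow (bitMat A) →
    Σ (Mat k₁ k₂ Bool) λ A' → Σ (Mat k₁ ℓ ℤ₄) λ B' → Σ (Mat k₂ ℓ Bool) λ D' →
      Prow (bitMat A') × InB B' ×
      Equivalent (Code (GABD A B D)) (Code (GABD A' B' D'))
lemma5p2 k₁ k₂ ℓ A B D A-sorted with signCols-into-𝓑 B
... | t , signed∈𝓑 =
  A , signCols B t , D , A-sorted , signed∈𝓑 , GABD-signCols-equivalent A B D t
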